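{- Let $\Omega:\mathcal{T}\to\mathcal{T}$ be a computable total map such that $\Omega(T)\in\mathcal{D}_{\mathcal{T}}$ for every $T$ and $(\Omega(T))'=T'$ whenever $T\in\mathcal{D}_{\mathcal{T}}$. There is no (stably) computable map $D:\mathcal{T}\times\mathbb{N}\to\{\pm\}$ that is stably sound and complete; that is, if $D$ is stably sound and complete then $\neg\Theta_{D,T}$ for every $T\in\mathcal{T}$.
   Context: "Map" means partial map unless called total. $\mathcal{T}$ is the set of Turing machines $\mathbb{N}\to\mathbb{N}$ with a standard Gödel encoding $e_{\mathcal{T}}$; $\mathbb{N}$ is encoded by the identity, $\{\pm\}$ by $-\mapsto0,+\mapsto1$, products by $(a,b)\mapsto2^{e_A(a)}3^{e_B(b)}$. $\mathcal{D}_{\mathcal{T}}$ is the set of $T\in\mathcal{T}$ for which there is a (unique) map $T':\mathcal{T}\times\mathbb{N}\to\{\pm\}$ with $e_{\{\pm\}}\circ T'=T\circ e_{\mathcal{T}\times\mathbb{N}}$. For a map $D:\mathcal{T}\times\mathbb{N}\to\{\pm\}$, $b\in\mathcal{T}$ is $D$-decided if there is $m$ with $D(b,m)=+$ and $D(b,n)\neq-$ for all $n\ge m$; for $S\in\mathcal{D}_{\mathcal{T}}$, $b$ is $S$-decided if it is $S'$-decided. $s(T)$ is the statement "$T$ is not $\Omega(T)$-decided". $D$ is stably sound if for all $T$, ($T$ is $D$-decided) implies $s(T)$; $D$ stably decides $T$ if $s(T)$ implies ($T$ is $D$-decided); $D$ is stably sound and complete if it is stably sound and stably decides every $T\in\mathcal{T}$.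 Two maps $\mathcal{T}\times\mathbb{N}\to\{\pm\}$ are stably equivalent if they have the same decided elements; $\Theta_{D,T}$ is the statement "$T$ stably computes $D$", i.e. $T\in\mathcal{D}_{\mathcal{T}}$ and $T'$ is stably equivalent to $D$. $D$ is (stably) computable if $\Theta_{D,T}$ holds for some $T$. -}

module Defs where

open import Data.Nat using (ℕ; zero; suc; _+_; _*_; _^_; _≤_; _<_)
open import Data.Product using (Σ; _×_; _,_; proj₁; proj₂)
open import Data.Sum using (_⊎_)
open import Data.Empty using (⊥)
open import Relation.Nullary using (¬_)
open import Relation.Binary.PropositionalEquality using (_≡_)
open import Function.Bundles using (_⇔_)

tri : ℕ → ℕ
tri zero    = zero
tri (suc n) = tri n + suc n

⟪_,_⟫ : ℕ → ℕ → ℕ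
⟪ a , b ⟫ = tri (a + b) + b

-- inverse of ⟪_,_⟫, by enumerating (0,0),(1,0),(0,1),(2,0),(1,1),(0,2),…
unpair : ℕ → ℕ × ℕ
unpair zero = 0 , 0
unpair (suc n) with unpair n
... | zero  , b = suc b , 0
... | suc a , b = a , suc b

-- The machine model 𝒯 : programs computing partial maps ℕ → ℕ.
-- (A Turing-complete basis of unary partial recursive functions, standing
-- in for Turing machines.)

data 𝒯 : Set where
  zer  : 𝒯
  sucᵀ : 𝒯
  idᵀ  : 𝒯
  fstᵀ : 𝒯
  sndᵀ : 𝒯
  comp : 𝒯 → 𝒯 → 𝒯
  pair : 𝒯 → 𝒯 → 𝒯
  prec : 𝒯 → 𝒯 → 𝒯
  mu   : 𝒯 → 𝒯

data Eval : 𝒯 → ℕ → ℕ → Set where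
  ev-zer  : ∀ {x} → Eval zer x 0
  ev-suc  : ∀ {x} → Eval sucᵀ x (suc x)
  ev-id   : ∀ {x} → Eval idᵀ x x
  ev-fst  : ∀ {x} → Eval fstᵀ x (proj₁ (unpair x))
  ev-snd  : ∀ {x} → Eval sndᵀ x (proj₂ (unpair x))
  ev-comp : ∀ {f g x y z} → Eval g x y → Eval f y z → Eval (comp f g) x z
  ev-pair : ∀ {f g x a b} → Eval f x a → Eval g x b → Eval (pair f g) x ⟪ a , b ⟫
  ev-prec0 : ∀ {f g x a z} → unpair x ≡ (a , 0) → Eval f a z → Eval (prec f g) x z
  ev-precS : ∀ {f g x a n r z} → unpair x ≡ (a , suc n) →
             Eval (prec f g) ⟪ a , n ⟫ r → Eval g ⟪ a , ⟪ n , r ⟫ ⟫ z →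
             Eval (prec f g) x z
  ev-mu   : ∀ {f x n} → Eval f ⟪ x , n ⟫ 0 →
            (∀ k → k < n → Σ ℕ λ v → Eval f ⟪ x , k ⟫ (suc v)) →
            Eval (mu f) x n

e𝒯 : 𝒯 → ℕ
e𝒯 zer        = ⟪ 0 , 0 ⟫
e𝒯 sucᵀ       = ⟪ 1 , 0 ⟫
e𝒯 idᵀ        = ⟪ 2 , 0 ⟫
e𝒯 fstᵀ       = ⟪ 3 , 0 ⟫
e𝒯 sndᵀ       = ⟪ 4 , 0 ⟫
e𝒯 (comp f g) = ⟪ 5 , ⟪ e𝒯 f , e𝒯 g ⟫ ⟫
e𝒯 (pair f g) = ⟪ 6 , ⟪ e𝒯 f , e𝒯 g ⟫ ⟫
e𝒯 (prec f g) = ⟪ 7 , ⟪ e𝒯 f , e𝒯 g ⟫ ⟫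
e𝒯 (mu f)     = ⟪ 8 , e𝒯 f ⟫

data Sign : Set where
  minus plus : Sign

e± : Sign → ℕ
e± minus = 0
e± plus  = 1

e𝒯×ℕ : 𝒯 × ℕ → ℕ
e𝒯×ℕ (b , m) = 2 ^ e𝒯 b * 3 ^ m

-- Partial maps A → B, as functional relations

PMap : Set → Set → Set₁
PMap A B = A → B → Set

Functional : ∀ {A B} → PMap A B → Set
Functional {A} {B} F = ∀ (a : A) (b b' : B) → F a b → F a b' → b ≡ b'

-- T' (the unique such map, when T ∈ 𝒟_𝒯)
_′ : 𝒯 → PMap (𝒯 × ℕ) Sign
(T ′) p s = Eval T (e𝒯×ℕ p) (e± s)

In𝒟 : 𝒯 → Set₁
In𝒟 T = Σ (PMap (𝒯 × ℕ) Sign) λ T' → Functional T' ×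
          (∀ p v → Eval T (e𝒯×ℕ p) v ⇔ (Σ Sign λ s → T' p s × e± s ≡ v))

Decided : PMap (𝒯 × ℕ) Sign → 𝒯 → Set
Decided D b = Σ ℕ λ m → D (b , m) plus × (∀ n → m ≤ n → ¬ D (b , n) minus)

s : (𝒯 → 𝒯) → 𝒯 → Set
s Ω T = ¬ Decided ((Ω T) ′) T

StablySound : (𝒯 → 𝒯) → PMap (𝒯 × ℕ) Sign → Set
StablySound Ω D = ∀ T → Decided D T → s Ω T

StablyDecides : (𝒯 → 𝒯) → PMap (𝒯 × ℕ) Sign → 𝒯 → Set
StablyDecides Ω D T = s Ω T → Decided D T

StablySoundAndComplete : (𝒯 → 𝒯) → PMap (𝒯 × ℕ) Sign → Set
StablySoundAndComplete Ω D = StablySound Ω D × (∀ T → StablyDecides Ω D T)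

StablyEquivalent : PMap (𝒯 × ℕ) Sign → PMap (𝒯 × ℕ) Sign → Set
StablyEquivalent D E = ∀ b → Decided D b ⇔ Decided E b

Θ : PMap (𝒯 × ℕ) Sign → 𝒯 → Set₁
Θ D T = In𝒟 T × StablyEquivalent (T ′) D

ComputableTotal : (𝒯 → 𝒯) → Set
ComputableTotal Ω = Σ 𝒯 λ C → ∀ T v → Eval C (e𝒯 T) v ⇔ (v ≡ e𝒯 (Ω T))

{-# OPTIONS --safe #-}
module Submission where

open import Defs
open import Data.Nat using (ℕ)
open import Data.Product using (_×_; _,_)
open import Function using (_∘_)
open import Relation.Nullary using (¬_)
open import Function.Bundles using (_⇔_; mk⇔; Equivalence)
import Function.Properties.Equivalence as ⇔

-- A diagonal argument on the machine T itself: if T stably computes D, then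
-- T is D-decided iff it is T′-decided iff it is Ω(T)′-decided, i.e. iff s(T)
-- fails. Soundness and completeness of D say instead that T is D-decided iff
-- s(T) holds, so s(T) would be equivalent to its own negation.

Decided-mono : (D E : PMap (𝒯 × ℕ) Sign) →
  (∀ p → D p plus → E p plus) → (∀ p → E p minus → D p minus) →
  ∀ b → Decided D b → Decided E b
Decided-mono D E plus⇒ minus⇐ b (m , D⁺ , ¬D⁻) =
  m , plus⇒ (b , m) D⁺ , λ n m≤n → ¬D⁻ n m≤n ∘ minus⇐ (b , n)

pointwise⇔⇒stablyEquivalent : (D E : PMap (𝒯 × ℕ) Sign) →
  (∀ p σ → D p σ ⇔ E p σ) → StablyEquivalent D E
pointwise⇔⇒stablyEquivalent D E D⇔E b = mk⇔
  (Decided-mono D E (λ p → Equivalence.to (D⇔E p plus)) (λ p → Equivalence.from (D⇔E p minus)) b)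
  (Decided-mono E D (λ p → Equivalence.from (D⇔E p plus)) (λ p → Equivalence.to (D⇔E p minus)) b)

stablyEquivalent-trans : (D E F : PMap (𝒯 × ℕ) Sign) →
  StablyEquivalent D E → StablyEquivalent E F → StablyEquivalent D F
stablyEquivalent-trans D E F D≈E E≈F b = ⇔.trans (D≈E b) (E≈F b)

sound∧decides⇒¬agreesWithΩ : ∀ {Ω} D T → StablySound Ω D → StablyDecides Ω D T →
  ¬ (Decided ((Ω T) ′) T ⇔ Decided D T)
sound∧decides⇒¬agreesWithΩ D T sound decides Ω⇔D =
  undecided (decides (undecided ∘ Equivalence.to Ω⇔D))
  where
    undecided : ¬ Decided D T
    undecided d = sound T d (Equivalence.from Ω⇔D d)

theorem4p5 : (Ω : 𝒯 → 𝒯) → ComputableTotal Ω →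
    (∀ T → In𝒟 (Ω T)) →
    (∀ T → In𝒟 T → ∀ p σ → ((Ω T) ′) p σ ⇔ (T ′) p σ) →
    (D : PMap (𝒯 × ℕ) Sign) → Functional D →
    StablySoundAndComplete Ω D → ∀ T → ¬ Θ D T
theorem4p5 Ω _ _ Ω′⇔T′ D _ (sound , complete) T (T∈𝒟 , T′≈D) =
  sound∧decides⇒¬agreesWithΩ D T sound (complete T) (Ω′≈D T)
  where
    Ω′≈D : StablyEquivalent ((Ω T) ′) D
    Ω′≈D = stablyEquivalent-trans ((Ω T) ′) (T ′) D
             (pointwise⇔⇒stablyEquivalent ((Ω T) ′) (T ′) (Ω′⇔T′ T T∈𝒟)) T′≈D
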